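{- Let $m$ and $N$ be integers with $|m| \ge 100$ such that $k_{N+1} < \frac{k_m}{12(1+4k_m)} \le k_N$. Then \[ \frac{k_m}{12(1 + 4k_m)}(\ell_{N + 1} - \ell_N) + \left(\frac{\ell_{m}}{12(1 + 4k_m)} + \frac{11}{12}\right)(k_N - k_{N + 1}) \ge k_N\ell_{N + 1} - \ell_N k_{N + 1}. \]
   Context: Define maps $A(k,\ell) := \left(\frac{k}{2k+2}, \frac{\ell}{2k+2} + \frac12\right)$ and $B(k,\ell) := \left(\ell - \frac12, k + \frac12\right)$. For integers $m \ge 3$ let $p_m = \frac{2}{(m-1)^2(m+2)}$ and $q_m = 1 - \frac{3m-2}{m(m-1)(m+2)}$. Define points $(k_n,\ell_n)$ for all integers $n$ by $(k_0,\ell_0) = (\frac{13}{84},\frac{55}{84})$, $(k_1,\ell_1) = (\frac{4742}{38463},\frac{35731}{51284})$, $(k_2,\ell_2) = (\frac{18}{199},\frac{593}{796})$, $(k_3,\ell_3) = (\frac{2779}{38033},\frac{58699}{76066})$, $(k_4,\ell_4) = (\frac{715}{10238},\frac{7955}{10238})$, and $(k_n,\ell_n) = A(k_{n-4},\ell_{n-4})$ for $5 \le n \le 8$, $(k_n,\ell_n) = (p_{n-4},q_{n-4})$ for $n \ge 9$, $(k_n,\ell_n) = B(k_{ -n},\ell_{ -n})$ for $n < 0$. -}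

module Defs where

open import Data.Nat using (ℕ; zero; suc)
open import Data.Integer using (ℤ; +_; -[1+_])
open import Data.Rational using (ℚ; _/_; _+_; _-_; _*_; _÷_; 0ℚ; 1ℚ; ≢-nonZero)
open import Data.Rational.Properties using (_≟_)
open import Data.Product using (_×_; _,_; proj₁; proj₂)
open import Relation.Nullary using (yes; no)

-- Total division on ℚ: x ⊘ y = x / y for y ≠ 0 (and 0 when y = 0;
-- this case never arises for the denominators used below).
_⊘_ : ℚ → ℚ → ℚ
x ⊘ y with y ≟ 0ℚ
... | yes _ = 0ℚ
... | no y≢0 = _÷_ x y {{≢-nonZero y≢0}}

half : ℚ
half = + 1 / 2

mapA : ℚ × ℚ → ℚ × ℚ
mapA (k , l) = (k ⊘ ((+ 2 / 1) * k + + 2 / 1) , (l ⊘ ((+ 2 / 1) * k + + 2 / 1)) + half)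

mapB : ℚ × ℚ → ℚ × ℚ
mapB (k , l) = (l - half , k + half)

ℕ→ℚ : ℕ → ℚ
ℕ→ℚ n = + n / 1

p : ℕ → ℚ
p m = (+ 2 / 1) ⊘ ((M - 1ℚ) * (M - 1ℚ) * (M + + 2 / 1))
  where M = ℕ→ℚ m

q : ℕ → ℚ
q m = 1ℚ - ((+ 3 / 1) * M - + 2 / 1) ⊘ (M * (M - 1ℚ) * (M + + 2 / 1))
  where M = ℕ→ℚ m

kℓℕ : ℕ → ℚ × ℚ
kℓℕ 0 = (+ 13 / 84 , + 55 / 84)
kℓℕ 1 = (+ 4742 / 38463 , + 35731 / 51284)
kℓℕ 2 = (+ 18 / 199 , + 593 / 796)
kℓℕ 3 = (+ 2779 / 38033 , + 58699 / 76066)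
kℓℕ 4 = (+ 715 / 10238 , + 7955 / 10238)
kℓℕ 5 = mapA (kℓℕ 1)
kℓℕ 6 = mapA (kℓℕ 2)
kℓℕ 7 = mapA (kℓℕ 3)
kℓℕ 8 = mapA (kℓℕ 4)
kℓℕ (suc (suc (suc (suc (suc (suc (suc (suc (suc r))))))))) =
  (p (5 Data.Nat.+ r) , q (5 Data.Nat.+ r))

kℓ : ℤ → ℚ × ℚ
kℓ (+ n) = kℓℕ n
kℓ -[1+ n ] = mapB (kℓℕ (suc n))

k : ℤ → ℚ
k n = proj₁ (kℓ n)

ℓ : ℤ → ℚ
ℓ n = proj₂ (kℓ n)

-- Put (X, Y) = Φ (k_m, ℓ_m). The inequality says that (X, Y), (k_N, ℓ_N), (k_{N+1}, ℓ_{N+1})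
-- are in clockwise order, which holds as soon as k_{N+1} ≤ X ≤ k_N and ℓ_N ≤ ℓ_{N+1} ≤ Y.
-- Since X ≤ 1/72 < 1/56 = k_9, the hypotheses force N ≥ 9, where (k_N, ℓ_N) = (p_{N-4}, q_{N-4})
-- and q is increasing. For m ≥ 100, with c = m - 4, the bound X ≤ p_{N-4} forces N - 4 < 3c,
-- and N - 3 ≤ 3c in turn gives q_{N-3} ≤ Y; after clearing denominators both are polynomial
-- inequalities in the offsets of N and c, with nonnegative coefficients. For m ≤ -100 one has
-- X ≥ 1/80 > 1/100 ≥ k_{N+1} unless N = 9, and that case follows from crude bounds on (X, Y).

module Submission where

open import Defs
open import Data.Nat using (_≥_)
open import Data.Integer using (ℤ; ∣_∣) renaming (_+_ to _+ℤ_; 1ℤ to 1ℤ)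
open import Data.Rational using (ℚ; _/_; _+_; _-_; _*_; _<_; _≤_; 1ℚ)

open import Data.Bool as Bool using (Bool; true; false; _∧_)
open import Data.Bool.Properties using (T-∧)
open import Data.Empty using (⊥; ⊥-elim)
import Data.Fin as Fin
open import Data.Integer as ℤ using (+_; -[1+_])
import Data.Integer.Properties as ℤₚ
open import Data.Nat as ℕ using (ℕ; suc)
import Data.Nat.Coprimality as Coprime
import Data.Nat.Properties as ℕₚ
open import Data.Product using (∃-syntax; _×_; _,_; proj₁; proj₂)
open import Data.Rational using (0ℚ; -_; _÷_; 1/_; mkℚ; _≤ᵇ_; positive; nonNegative; ≢-nonZero)
import Data.Rational.Properties as ℚₚ
open import Data.Rational.Solver using (module +-*-Solver)
open +-*-Solver
open import Data.Unit using (tt)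
open import Data.Vec using (Vec; []; _∷_; map; lookup)
open import Data.Vec.Properties using (lookup-map)
open import Function using (Equivalence)
open import Relation.Nullary using (yes; no; ¬_)
open import Relation.Binary.PropositionalEquality

p≤q⇒0≤q-p : ∀ {p q} → p ≤ q → 0ℚ ≤ q - p
p≤q⇒0≤q-p {p} {q} p≤q = subst (_≤ q - p) (ℚₚ.+-inverseʳ p) (ℚₚ.+-monoˡ-≤ (- p) p≤q)

p+[q-p]≡q : ∀ p q → p + (q - p) ≡ q
p+[q-p]≡q = solve 2 (λ p q → p :+ (q :- p) := q) refl

0≤q-p⇒p≤q : ∀ {p q} → 0ℚ ≤ q - p → p ≤ q
0≤q-p⇒p≤q {p} {q} 0≤q-p = subst₂ _≤_ (ℚₚ.+-identityʳ p) (p+[q-p]≡q p q) (ℚₚ.+-monoʳ-≤ p 0≤q-p)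

0<q-p⇒p<q : ∀ {p q} → 0ℚ < q - p → p < q
0<q-p⇒p<q {p} {q} 0<q-p = subst₂ _<_ (ℚₚ.+-identityʳ p) (p+[q-p]≡q p q) (ℚₚ.+-monoʳ-< p 0<q-p)

≤⇒≯ : ∀ {p q} → p ≤ q → q < p → ⊥
≤⇒≯ p≤q q<p = ℚₚ.<-irrefl refl (ℚₚ.<-≤-trans q<p p≤q)

0≤p*q : ∀ {p q} → 0ℚ ≤ p → 0ℚ ≤ q → 0ℚ ≤ p * q
0≤p*q {p} {q} 0≤p 0≤q =
  ℚₚ.nonNegative⁻¹ (p * q) {{ℚₚ.nonNeg*nonNeg⇒nonNeg p {{nonNegative 0≤p}} q {{nonNegative 0≤q}}}}

0<p*q : ∀ {p q} → 0ℚ < p → 0ℚ < q → 0ℚ < p * q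
0<p*q {p} {q} 0<p 0<q = ℚₚ.positive⁻¹ (p * q) {{ℚₚ.pos*pos⇒pos p {{positive 0<p}} q {{positive 0<q}}}}

0≤-cancelʳ : ∀ {p w} → 0ℚ < w → 0ℚ ≤ p * w → 0ℚ ≤ p
0≤-cancelʳ {p} {w} 0<w 0≤pw =
  ℚₚ.*-cancelʳ-≤-pos w {{positive 0<w}} (subst (_≤ p * w) (sym (ℚₚ.*-zeroˡ w)) 0≤pw)

0<-cancelʳ : ∀ {p w} → 0ℚ < w → 0ℚ < p * w → 0ℚ < p
0<-cancelʳ {p} {w} 0<w 0<pw =
  ℚₚ.*-cancelʳ-<-nonNeg w {{nonNegative (ℚₚ.<⇒≤ 0<w)}} (subst (_< p * w) (sym (ℚₚ.*-zeroˡ w)) 0<pw)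

⊘-cancelʳ : ∀ p {q} → 0ℚ < q → (p ⊘ q) * q ≡ p
⊘-cancelʳ p {q} 0<q with q ℚₚ.≟ 0ℚ
... | yes q≡0 = ⊥-elim (ℚₚ.<-irrefl (sym q≡0) 0<q)
... | no q≢0 = begin
  p ÷ q * q       ≡⟨ ℚₚ.*-assoc p (1/ q) q ⟩
  p * (1/ q * q)  ≡⟨ cong (p *_) (ℚₚ.*-inverseˡ q) ⟩
  p * 1ℚ          ≡⟨ ℚₚ.*-identityʳ p ⟩
  p               ∎
  where open ≡-Reasoning
        instance _ = ≢-nonZero q≢0

⊘-≤ : ∀ {p q r} → 0ℚ < q → p ≤ r * q → p ⊘ q ≤ r
⊘-≤ {p} {q} {r} 0<q p≤rq =
  ℚₚ.*-cancelʳ-≤-pos q {{positive 0<q}} (subst (_≤ r * q) (sym (⊘-cancelʳ p 0<q)) p≤rq)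

≤-⊘ : ∀ {p q r} → 0ℚ < q → r * q ≤ p → r ≤ p ⊘ q
≤-⊘ {p} {q} {r} 0<q rq≤p =
  ℚₚ.*-cancelʳ-≤-pos q {{positive 0<q}} (subst (r * q ≤_) (sym (⊘-cancelʳ p 0<q)) rq≤p)

-- Polynomials with nonnegative coefficients

nonNegCoeffs : ∀ {n} → Polynomial n → Bool
nonNegCoeffs (op _ e₁ e₂) = nonNegCoeffs e₁ ∧ nonNegCoeffs e₂
nonNegCoeffs (con c)      = 0ℚ ≤ᵇ c
nonNegCoeffs (var _)      = true
nonNegCoeffs (_ :^ _)     = false
nonNegCoeffs (:- _)       = false

ℕ→ℚ-nonNeg : ∀ n → 0ℚ ≤ ℕ→ℚ n
ℕ→ℚ-nonNeg n = ℚₚ.nonNegative⁻¹ (ℕ→ℚ n) {{ℚₚ.normalize-nonNeg n 1}}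

0≤⟦⟧ : ∀ {n} (e : Polynomial n) (xs : Vec ℕ n) → Bool.T (nonNegCoeffs e) → 0ℚ ≤ ⟦ e ⟧ (map ℕ→ℚ xs)
0≤⟦⟧ (op [+] e₁ e₂) xs ok =
  ℚₚ.+-mono-≤ (0≤⟦⟧ e₁ xs (proj₁ (Equivalence.to T-∧ ok))) (0≤⟦⟧ e₂ xs (proj₂ (Equivalence.to T-∧ ok)))
0≤⟦⟧ (op [*] e₁ e₂) xs ok =
  0≤p*q (0≤⟦⟧ e₁ xs (proj₁ (Equivalence.to T-∧ ok))) (0≤⟦⟧ e₂ xs (proj₂ (Equivalence.to T-∧ ok)))
0≤⟦⟧ (con c) xs ok = ℚₚ.≤ᵇ⇒≤ ok
0≤⟦⟧ (var i) xs ok = subst (0ℚ ≤_) (sym (lookup-map i ℕ→ℚ xs)) (ℕ→ℚ-nonNeg (lookup xs i))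

0<1+⟦⟧ : ∀ {n} (e : Polynomial n) (xs : Vec ℕ n) → Bool.T (nonNegCoeffs e) → 0ℚ < 1ℚ + ⟦ e ⟧ (map ℕ→ℚ xs)
0<1+⟦⟧ e xs ok = ℚₚ.+-mono-<-≤ (ℚₚ.positive⁻¹ 1ℚ) (0≤⟦⟧ e xs ok)

v₀ : ∀ {n} → Polynomial (suc n)
v₀ = var Fin.zero

v₁ : ∀ {n} → Polynomial (suc (suc n))
v₁ = var (Fin.suc Fin.zero)

v₂ : ∀ {n} → Polynomial (suc (suc (suc n)))
v₂ = var (Fin.suc (Fin.suc Fin.zero))

/1≡mkℚ : ∀ i → i / 1 ≡ mkℚ i 0 (Coprime.sym (Coprime.1-coprimeTo ∣ i ∣))
/1≡mkℚ i = ℚₚ.↥p/↧p≡p (mkℚ i 0 (Coprime.sym (Coprime.1-coprimeTo ∣ i ∣)))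

ℕ→ℚ-+ : ∀ m n → ℕ→ℚ (m ℕ.+ n) ≡ ℕ→ℚ m + ℕ→ℚ n
ℕ→ℚ-+ m n rewrite /1≡mkℚ (+ m) | /1≡mkℚ (+ n) =
  ℚₚ./-cong (sym (cong₂ ℤ._+_ (ℤₚ.*-identityʳ (+ m)) (ℤₚ.*-identityʳ (+ n)))) refl

ℕ→ℚ-* : ∀ m n → ℕ→ℚ (m ℕ.* n) ≡ ℕ→ℚ m * ℕ→ℚ n
ℕ→ℚ-* m n rewrite /1≡mkℚ (+ m) | /1≡mkℚ (+ n) = cong (_/ 1) (ℤₚ.pos-* m n)

pDen qDen : ℚ → ℚ
pDen M = (M - 1ℚ) * (M - 1ℚ) * (M + + 2 / 1)
qDen M = M * (M - 1ℚ) * (M + + 2 / 1)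

:pDen :qDen : ∀ {n} → Polynomial n → Polynomial n
:pDen M = (M :- con 1ℚ) :* (M :- con 1ℚ) :* (M :+ con (+ 2 / 1))
:qDen M = M :* (M :- con 1ℚ) :* (M :+ con (+ 2 / 1))

pDen-pos : ∀ {n} → 2 ℕ.≤ n → 0ℚ < pDen (ℕ→ℚ n)
pDen-pos 2≤n with ℕₚ.m≤n⇒∃[o]m+o≡n 2≤n
... | s , refl = subst (λ M → 0ℚ < pDen M) (sym (ℕ→ℚ-+ 2 s))
  (subst (0ℚ <_)
    (solve 1 (λ s → con 1ℚ :+ (con (+ 3 / 1) :+ con (+ 9 / 1) :* s :+ con (+ 6 / 1) :* s :* s :+ s :* s :* s)
                    := :pDen (con (+ 2 / 1) :+ s)) refl (ℕ→ℚ s))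
    (0<1+⟦⟧ (con (+ 3 / 1) :+ con (+ 9 / 1) :* v₀ :+ con (+ 6 / 1) :* v₀ :* v₀ :+ v₀ :* v₀ :* v₀) (s ∷ []) tt))

qDen-pos : ∀ {n} → 2 ℕ.≤ n → 0ℚ < qDen (ℕ→ℚ n)
qDen-pos 2≤n with ℕₚ.m≤n⇒∃[o]m+o≡n 2≤n
... | s , refl = subst (λ M → 0ℚ < qDen M) (sym (ℕ→ℚ-+ 2 s))
  (subst (0ℚ <_)
    (solve 1 (λ s → con 1ℚ :+ (con (+ 7 / 1) :+ con (+ 14 / 1) :* s :+ con (+ 7 / 1) :* s :* s :+ s :* s :* s)
                    := :qDen (con (+ 2 / 1) :+ s)) refl (ℕ→ℚ s))
    (0<1+⟦⟧ (con (+ 7 / 1) :+ con (+ 14 / 1) :* v₀ :+ con (+ 7 / 1) :* v₀ :* v₀ :+ v₀ :* v₀ :* v₀) (s ∷ []) tt))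

p*pDen : ∀ {n} → 2 ℕ.≤ n → p n * pDen (ℕ→ℚ n) ≡ + 2 / 1
p*pDen {n} 2≤n = ⊘-cancelʳ (+ 2 / 1) (pDen-pos 2≤n)

[1-q]*qDen : ∀ {n} → 2 ℕ.≤ n → (1ℚ - q n) * qDen (ℕ→ℚ n) ≡ + 3 / 1 * ℕ→ℚ n - + 2 / 1
[1-q]*qDen {n} 2≤n = trans (cong (_* qDen M) (1-[1-x]≡x ((+ 3 / 1 * M - + 2 / 1) ⊘ qDen M))) (⊘-cancelʳ (+ 3 / 1 * M - + 2 / 1) (qDen-pos 2≤n))
  where
  M = ℕ→ℚ n
  1-[1-x]≡x : ∀ x → 1ℚ - (1ℚ - x) ≡ x
  1-[1-x]≡x = solve 1 (λ x → con 1ℚ :- (con 1ℚ :- x) := x) refl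

p-nonNeg : ∀ {n} → 2 ℕ.≤ n → 0ℚ ≤ p n
p-nonNeg 2≤n = 0≤-cancelʳ (pDen-pos 2≤n) (subst (0ℚ ≤_) (sym (p*pDen 2≤n)) (ℚₚ.≤ᵇ⇒≤ tt))

q≤1 : ∀ s → q (2 ℕ.+ s) ≤ 1ℚ
q≤1 s = 0≤q-p⇒p≤q (0≤-cancelʳ (qDen-pos 2≤2+s) (subst (0ℚ ≤_) (sym cleared) (0≤⟦⟧ (con (+ 4 / 1) :+ con (+ 3 / 1) :* v₀) (s ∷ []) tt)))
  where
  2≤2+s = ℕₚ.m≤m+n 2 s
  cleared : (1ℚ - q (2 ℕ.+ s)) * qDen (ℕ→ℚ (2 ℕ.+ s)) ≡ + 4 / 1 + + 3 / 1 * ℕ→ℚ s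
  cleared = trans ([1-q]*qDen 2≤2+s)
    (trans (cong (λ M → + 3 / 1 * M - + 2 / 1) (ℕ→ℚ-+ 2 s))
      (solve 1 (λ s → con (+ 3 / 1) :* (con (+ 2 / 1) :+ s) :- con (+ 2 / 1) := con (+ 4 / 1) :+ con (+ 3 / 1) :* s) refl (ℕ→ℚ s)))

7/8≤q : ∀ s → + 7 / 8 ≤ q (5 ℕ.+ s)
7/8≤q s = 0≤q-p⇒p≤q (0≤-cancelʳ (qDen-pos 2≤5+s) (subst (0ℚ ≤_) (sym cleared) (0≤⟦⟧ (bound v₀) (s ∷ []) tt)))
  where
  2≤5+s = ℕₚ.m≤m+n 2 (3 ℕ.+ s)
  M = ℕ→ℚ (5 ℕ.+ s)
  bound : ∀ {n} → Polynomial n → Polynomial n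
  bound s = con (+ 9 / 2) :+ con (+ 59 / 8) :* s :+ con (+ 2 / 1) :* s :* s :+ con (+ 1 / 8) :* s :* s :* s
  cleared : (q (5 ℕ.+ s) - + 7 / 8) * qDen M ≡ ⟦ bound v₀ ⟧ (ℕ→ℚ s ∷ [])
  cleared = begin
    (q (5 ℕ.+ s) - + 7 / 8) * qDen M
      ≡⟨ solve 2 (λ x e → (x :- con (+ 7 / 8)) :* e := e :* con (+ 1 / 8) :- (con 1ℚ :- x) :* e) refl (q (5 ℕ.+ s)) (qDen M) ⟩
    qDen M * (+ 1 / 8) - (1ℚ - q (5 ℕ.+ s)) * qDen M
      ≡⟨ cong (λ a → qDen M * (+ 1 / 8) - a) ([1-q]*qDen 2≤5+s) ⟩
    qDen M * (+ 1 / 8) - (+ 3 / 1 * M - + 2 / 1)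
      ≡⟨ cong (λ M → qDen M * (+ 1 / 8) - (+ 3 / 1 * M - + 2 / 1)) (ℕ→ℚ-+ 5 s) ⟩
    _ ≡⟨ solve 1 (λ s → :qDen (con (+ 5 / 1) :+ s) :* con (+ 1 / 8) :- (con (+ 3 / 1) :* (con (+ 5 / 1) :+ s) :- con (+ 2 / 1))
                        := bound s) refl (ℕ→ℚ s) ⟩
    ⟦ bound v₀ ⟧ (ℕ→ℚ s ∷ []) ∎
    where open ≡-Reasoning

p≤1/100 : ∀ s → p (6 ℕ.+ s) ≤ + 1 / 100
p≤1/100 s = 0≤q-p⇒p≤q (0≤-cancelʳ (pDen-pos 2≤6+s) (subst (0ℚ ≤_) (sym cleared) (0≤⟦⟧ (bound v₀) (s ∷ []) tt)))
  where
  2≤6+s = ℕₚ.m≤m+n 2 (4 ℕ.+ s)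
  M = ℕ→ℚ (6 ℕ.+ s)
  bound : ∀ {n} → Polynomial n → Polynomial n
  bound s = con (+ 21 / 20) :* s :+ con (+ 9 / 50) :* s :* s :+ con (+ 1 / 100) :* s :* s :* s
  cleared : (+ 1 / 100 - p (6 ℕ.+ s)) * pDen M ≡ ⟦ bound v₀ ⟧ (ℕ→ℚ s ∷ [])
  cleared = begin
    (+ 1 / 100 - p (6 ℕ.+ s)) * pDen M
      ≡⟨ solve 2 (λ x d → (con (+ 1 / 100) :- x) :* d := d :* con (+ 1 / 100) :- x :* d) refl (p (6 ℕ.+ s)) (pDen M) ⟩
    pDen M * (+ 1 / 100) - p (6 ℕ.+ s) * pDen M
      ≡⟨ cong (λ a → pDen M * (+ 1 / 100) - a) (p*pDen 2≤6+s) ⟩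
    pDen M * (+ 1 / 100) - + 2 / 1
      ≡⟨ cong (λ M → pDen M * (+ 1 / 100) - + 2 / 1) (ℕ→ℚ-+ 6 s) ⟩
    _ ≡⟨ solve 1 (λ s → :pDen (con (+ 6 / 1) :+ s) :* con (+ 1 / 100) :- con (+ 2 / 1) := bound s) refl (ℕ→ℚ s) ⟩
    ⟦ bound v₀ ⟧ (ℕ→ℚ s ∷ []) ∎
    where open ≡-Reasoning

q-mono : ∀ s → q (2 ℕ.+ s) ≤ q (3 ℕ.+ s)
q-mono s = 0≤q-p⇒p≤q (0≤-cancelʳ (0<p*q (qDen-pos 2≤n) (qDen-pos 2≤1+n)) (subst (0ℚ ≤_) (sym cleared) (0≤⟦⟧ (bound v₀) (s ∷ []) tt)))
  where
  n = 2 ℕ.+ s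
  2≤n = ℕₚ.m≤m+n 2 s
  2≤1+n = ℕₚ.m≤m+n 2 (suc s)
  M = ℕ→ℚ n
  bound : ∀ {n} → Polynomial n → Polynomial n
  bound s = con (+ 64 / 1) :+ con (+ 92 / 1) :* s :+ con (+ 42 / 1) :* s :* s :+ con (+ 6 / 1) :* s :* s :* s
  cleared : (q (suc n) - q n) * (qDen M * qDen (ℕ→ℚ (suc n))) ≡ ⟦ bound v₀ ⟧ (ℕ→ℚ s ∷ [])
  cleared = begin
    (q (suc n) - q n) * (qDen M * qDen (ℕ→ℚ (suc n)))
      ≡⟨ solve 4 (λ x y e f → (y :- x) :* (e :* f) := ((con 1ℚ :- x) :* e) :* f :- ((con 1ℚ :- y) :* f) :* e)
           refl (q n) (q (suc n)) (qDen M) (qDen (ℕ→ℚ (suc n))) ⟩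
    ((1ℚ - q n) * qDen M) * qDen (ℕ→ℚ (suc n)) - ((1ℚ - q (suc n)) * qDen (ℕ→ℚ (suc n))) * qDen M
      ≡⟨ cong₂ (λ a b → a * qDen (ℕ→ℚ (suc n)) - b * qDen M) ([1-q]*qDen 2≤n) ([1-q]*qDen 2≤1+n) ⟩
    (+ 3 / 1 * M - + 2 / 1) * qDen (ℕ→ℚ (suc n)) - (+ 3 / 1 * ℕ→ℚ (suc n) - + 2 / 1) * qDen M
      ≡⟨ cong₂ (λ M M′ → (+ 3 / 1 * M - + 2 / 1) * qDen M′ - (+ 3 / 1 * M′ - + 2 / 1) * qDen M)
           (ℕ→ℚ-+ 2 s) (ℕ→ℚ-+ 3 s) ⟩
    _ ≡⟨ solve 1 (λ s → (con (+ 3 / 1) :* (con (+ 2 / 1) :+ s) :- con (+ 2 / 1)) :* :qDen (con (+ 3 / 1) :+ s)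
                        :- (con (+ 3 / 1) :* (con (+ 3 / 1) :+ s) :- con (+ 2 / 1)) :* :qDen (con (+ 2 / 1) :+ s)
                        := bound s) refl (ℕ→ℚ s) ⟩
    ⟦ bound v₀ ⟧ (ℕ→ℚ s ∷ []) ∎
    where open ≡-Reasoning

-- The point Φ (k_m, ℓ_m) and orientation of triangles

scale : ℚ → ℚ
scale κ = + 12 / 1 * (1ℚ + + 4 / 1 * κ)

:scale : ∀ {n} → Polynomial n → Polynomial n
:scale κ = con (+ 12 / 1) :* (con 1ℚ :+ con (+ 4 / 1) :* κ)

Φ : ℚ × ℚ → ℚ × ℚ
Φ (κ , μ) = κ ⊘ scale κ , μ ⊘ scale κ + + 11 / 12

-- det (a − o) (b − o) ≤ 0, i.e. o, a, b are in clockwise order (or collinear)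
Clockwise : ℚ × ℚ → ℚ × ℚ → ℚ × ℚ → Set
Clockwise (x , y) (k₀ , l₀) (k₁ , l₁) = k₀ * l₁ - l₀ * k₁ ≤ x * (l₁ - l₀) + y * (k₀ - k₁)

clockwise-between : ∀ {x y k₀ l₀ k₁ l₁} → k₁ ≤ x → x ≤ k₀ → l₀ ≤ l₁ → l₁ ≤ y →
                    Clockwise (x , y) (k₀ , l₀) (k₁ , l₁)
clockwise-between {x} {y} {k₀} {l₀} {k₁} {l₁} k₁≤x x≤k₀ l₀≤l₁ l₁≤y = 0≤q-p⇒p≤q (subst (0ℚ ≤_) difference
  (ℚₚ.+-mono-≤ (0≤p*q (p≤q⇒0≤q-p l₁≤y) (p≤q⇒0≤q-p (ℚₚ.≤-trans k₁≤x x≤k₀)))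
               (0≤p*q (p≤q⇒0≤q-p k₁≤x) (p≤q⇒0≤q-p l₀≤l₁))))
  where
  difference : (y - l₁) * (k₀ - k₁) + (x - k₁) * (l₁ - l₀)
             ≡ (x * (l₁ - l₀) + y * (k₀ - k₁)) - (k₀ * l₁ - l₀ * k₁)
  difference = solve 6 (λ x y k₀ l₀ k₁ l₁ →
    (y :- l₁) :* (k₀ :- k₁) :+ (x :- k₁) :* (l₁ :- l₀) := (x :* (l₁ :- l₀) :+ y :* (k₀ :- k₁)) :- (k₀ :* l₁ :- l₀ :* k₁))
    refl x y k₀ l₀ k₁ l₁

clockwise-mono : ∀ {x y d e} {a b : ℚ × ℚ} → d ≤ x → e ≤ y → proj₂ a ≤ proj₂ b → proj₁ b ≤ proj₁ a →
                 Clockwise (d , e) a b → Clockwise (x , y) a b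
clockwise-mono {a = a} {b} d≤x e≤y l₀≤l₁ k₁≤k₀ cw = ℚₚ.≤-trans cw (ℚₚ.+-mono-≤
  (ℚₚ.*-monoʳ-≤-nonNeg (proj₂ b - proj₂ a) {{nonNegative (p≤q⇒0≤q-p l₀≤l₁)}} d≤x)
  (ℚₚ.*-monoʳ-≤-nonNeg (proj₁ a - proj₁ b) {{nonNegative (p≤q⇒0≤q-p k₁≤k₀)}} e≤y))

scale-pos : ∀ {κ} → 0ℚ ≤ κ → 0ℚ < scale κ
scale-pos {κ} 0≤κ = subst (0ℚ <_) (solve 1 (λ κ → con (+ 12 / 1) :+ con (+ 48 / 1) :* κ := :scale κ) refl κ)
  (ℚₚ.+-mono-<-≤ (ℚₚ.positive⁻¹ (+ 12 / 1)) (0≤p*q {+ 48 / 1} (ℚₚ.≤ᵇ⇒≤ tt) 0≤κ))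

⊘scale≤1/72 : ∀ {κ} → 0ℚ ≤ κ → κ ≤ half → κ ⊘ scale κ ≤ + 1 / 72
⊘scale≤1/72 {κ} 0≤κ κ≤1/2 = ⊘-≤ (scale-pos 0≤κ)
  (0≤q-p⇒p≤q (subst (0ℚ ≤_) (solve 1 (λ κ → con (+ 1 / 3) :* (con half :- κ) := con (+ 1 / 72) :* :scale κ :- κ) refl κ)
    (0≤p*q {+ 1 / 3} (ℚₚ.≤ᵇ⇒≤ tt) (p≤q⇒0≤q-p κ≤1/2))))

1/80≤⊘scale : ∀ {κ} → + 3 / 8 ≤ κ → + 1 / 80 ≤ κ ⊘ scale κ
1/80≤⊘scale {κ} 3/8≤κ = ≤-⊘ (scale-pos (ℚₚ.≤-trans (ℚₚ.≤ᵇ⇒≤ tt) 3/8≤κ))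
  (0≤q-p⇒p≤q (subst (0ℚ ≤_) (solve 1 (λ κ → con (+ 2 / 5) :* (κ :- con (+ 3 / 8)) := κ :- con (+ 1 / 80) :* :scale κ) refl κ)
    (0≤p*q {+ 2 / 5} (ℚₚ.≤ᵇ⇒≤ tt) (p≤q⇒0≤q-p 3/8≤κ))))

1/72≤⊘scale : ∀ {κ μ} → 0ℚ ≤ κ → κ ≤ half → half ≤ μ → + 1 / 72 ≤ μ ⊘ scale κ
1/72≤⊘scale {κ} {μ} 0≤κ κ≤1/2 1/2≤μ = ≤-⊘ (scale-pos 0≤κ)
  (0≤q-p⇒p≤q (subst (0ℚ ≤_)
    (solve 2 (λ κ μ → (μ :- con half) :+ con (+ 2 / 3) :* (con half :- κ) := μ :- con (+ 1 / 72) :* :scale κ) refl κ μ)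
    (ℚₚ.+-mono-≤ (p≤q⇒0≤q-p 1/2≤μ) (0≤p*q {+ 2 / 3} (ℚₚ.≤ᵇ⇒≤ tt) (p≤q⇒0≤q-p κ≤1/2)))))

-- Where k drops below 1/56 = k 9

kℓ-+1 : ∀ n → kℓ (+ n +ℤ 1ℤ) ≡ kℓ (+ suc n)
kℓ-+1 n = cong (λ m → kℓ (+ m)) (ℕₚ.+-comm n 1)

1/56≤k-neg : ∀ j → + 1 / 56 ≤ k -[1+ j ]
1/56≤k-neg 0 = ℚₚ.≤ᵇ⇒≤ tt
1/56≤k-neg 1 = ℚₚ.≤ᵇ⇒≤ tt
1/56≤k-neg 2 = ℚₚ.≤ᵇ⇒≤ tt
1/56≤k-neg 3 = ℚₚ.≤ᵇ⇒≤ tt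
1/56≤k-neg 4 = ℚₚ.≤ᵇ⇒≤ tt
1/56≤k-neg 5 = ℚₚ.≤ᵇ⇒≤ tt
1/56≤k-neg 6 = ℚₚ.≤ᵇ⇒≤ tt
1/56≤k-neg 7 = ℚₚ.≤ᵇ⇒≤ tt
1/56≤k-neg (suc (suc (suc (suc (suc (suc (suc (suc s)))))))) =
  ℚₚ.≤-trans (ℚₚ.≤ᵇ⇒≤ tt) (ℚₚ.+-monoˡ-≤ (- half) (7/8≤q s))

k[N+1]<1/56⇒9≤N : ∀ N → k (N +ℤ 1ℤ) < + 1 / 56 → ∃[ s ] N ≡ + (9 ℕ.+ s)
k[N+1]<1/56⇒9≤N (+ 0) h = ⊥-elim (≤⇒≯ (ℚₚ.≤ᵇ⇒≤ tt) h)
k[N+1]<1/56⇒9≤N (+ 1) h = ⊥-elim (≤⇒≯ (ℚₚ.≤ᵇ⇒≤ tt) h)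
k[N+1]<1/56⇒9≤N (+ 2) h = ⊥-elim (≤⇒≯ (ℚₚ.≤ᵇ⇒≤ tt) h)
k[N+1]<1/56⇒9≤N (+ 3) h = ⊥-elim (≤⇒≯ (ℚₚ.≤ᵇ⇒≤ tt) h)
k[N+1]<1/56⇒9≤N (+ 4) h = ⊥-elim (≤⇒≯ (ℚₚ.≤ᵇ⇒≤ tt) h)
k[N+1]<1/56⇒9≤N (+ 5) h = ⊥-elim (≤⇒≯ (ℚₚ.≤ᵇ⇒≤ tt) h)
k[N+1]<1/56⇒9≤N (+ 6) h = ⊥-elim (≤⇒≯ (ℚₚ.≤ᵇ⇒≤ tt) h)
k[N+1]<1/56⇒9≤N (+ 7) h = ⊥-elim (≤⇒≯ (ℚₚ.≤ᵇ⇒≤ tt) h)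
k[N+1]<1/56⇒9≤N (+ 8) h = ⊥-elim (≤⇒≯ (ℚₚ.≤ᵇ⇒≤ tt) h)
k[N+1]<1/56⇒9≤N (+ suc (suc (suc (suc (suc (suc (suc (suc (suc s))))))))) h = s , refl
k[N+1]<1/56⇒9≤N -[1+ 0 ] h = ⊥-elim (≤⇒≯ (ℚₚ.≤ᵇ⇒≤ tt) h)
k[N+1]<1/56⇒9≤N -[1+ suc j ] h = ⊥-elim (≤⇒≯ (1/56≤k-neg j) h)

-- The type of lemma4p5 unfolds to ∀ m N → ∣ m ∣ ≥ 100 → Claim m N (N +ℤ 1ℤ).
Claim : ℤ → ℤ → ℤ → Set
Claim m N N′ = k N′ < proj₁ (Φ (kℓ m)) → proj₁ (Φ (kℓ m)) ≤ k N → Clockwise (Φ (kℓ m)) (kℓ N) (kℓ N′)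

1/72<1/56 : + 1 / 72 < + 1 / 56
1/72<1/56 = ℚₚ.≰⇒> ℚₚ.≤⇒≤ᵇ

claim-from-9≤N : ∀ m → proj₁ (Φ (kℓ m)) < + 1 / 56 →
                   (∀ s → Claim m (+ (9 ℕ.+ s)) (+ (9 ℕ.+ s) +ℤ 1ℤ)) → ∀ N → Claim m N (N +ℤ 1ℤ)
-- let/subst instead of with: with-abstraction over these goals makes Agda normalise
-- the p's and q's inside them, which exhausts memory.
claim-from-9≤N m X<1/56 claim N k[N+1]<X =
  let (s , N≡9+s) = k[N+1]<1/56⇒9≤N N (ℚₚ.<-trans k[N+1]<X X<1/56)
  in subst (λ N → Claim m N (N +ℤ 1ℤ)) (sym N≡9+s) (claim s) k[N+1]<X

-- m = 100 + t, where (k_m, ℓ_m) = (p c, q c)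
module Positive (t : ℕ) where

  c : ℕ
  c = 96 ℕ.+ t

  2≤c : 2 ℕ.≤ c
  2≤c = ℕₚ.m≤m+n 2 (94 ℕ.+ t)

  C D E P Q Z X Y₀ : ℚ
  C = ℕ→ℚ c
  D = pDen C
  E = qDen C
  P = p c
  Q = q c
  Z = scale P
  X = P ⊘ Z
  Y₀ = Q ⊘ Z

  Z-pos : 0ℚ < Z
  Z-pos = scale-pos (p-nonNeg 2≤c)

  X≤1/72 : X ≤ + 1 / 72
  X≤1/72 = ⊘scale≤1/72 (p-nonNeg 2≤c) (ℚₚ.≤-trans (p≤1/100 (90 ℕ.+ t)) (ℚₚ.≤ᵇ⇒≤ tt))

  Z*D : Z * D ≡ + 12 / 1 * D + + 96 / 1
  Z*D = begin
    Z * D                               ≡⟨ solve 2 (λ x d → :scale x :* d := con (+ 12 / 1) :* d :+ con (+ 48 / 1) :* (x :* d)) refl P D ⟩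
    + 12 / 1 * D + + 48 / 1 * (P * D)   ≡⟨ cong (λ a → + 12 / 1 * D + + 48 / 1 * a) (p*pDen 2≤c) ⟩
    + 12 / 1 * D + + 96 / 1             ∎
    where open ≡-Reasoning

  ℕ→ℚ-3c : ℕ→ℚ (3 ℕ.* c) ≡ + 3 / 1 * (+ 96 / 1 + ℕ→ℚ t)
  ℕ→ℚ-3c = trans (ℕ→ℚ-* 3 c) (cong (λ a → + 3 / 1 * a) (ℕ→ℚ-+ 96 t))

  -- (X - p n) * Z * D * pDen N after substituting X * Z = p c, p c * D = 2 and p n * pDen N = 2
  pGap : ℚ → ℚ → ℚ
  pGap C N = + 2 / 1 * pDen N - (+ 12 / 1 * pDen C + + 96 / 1) * (+ 2 / 1)

  :pGap : ∀ {n} → Polynomial n → Polynomial n → Polynomial n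
  :pGap C N = con (+ 2 / 1) :* :pDen N :- (con (+ 12 / 1) :* :pDen C :+ con (+ 96 / 1)) :* con (+ 2 / 1)

  p<X : ∀ u → p (3 ℕ.* c ℕ.+ u) < X
  p<X u = 0<q-p⇒p<q (0<-cancelʳ (0<p*q (0<p*q Z-pos (pDen-pos 2≤c)) (pDen-pos 2≤n))
                     (subst (0ℚ <_) (sym cleared) (0<1+⟦⟧ (excess v₀ v₁) (t ∷ u ∷ []) tt)))
    where
    n = 3 ℕ.* c ℕ.+ u
    N = ℕ→ℚ n
    2≤n : 2 ℕ.≤ n
    2≤n = ℕ.s≤s (ℕ.s≤s ℕ.z≤n)
    excess : ∀ {n} → Polynomial n → Polynomial n → Polynomial n
    excess t u = con (+ 26547027 / 1) :+ con (+ 497658 / 1) :* u :+ con (+ 1728 / 1) :* u :* u :+ con (+ 2 / 1) :* u :* u :* u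
      :+ con (+ 829494 / 1) :* t :+ con (+ 10368 / 1) :* t :* u :+ con (+ 18 / 1) :* t :* u :* u
      :+ con (+ 8640 / 1) :* t :* t :+ con (+ 54 / 1) :* t :* t :* u :+ con (+ 30 / 1) :* t :* t :* t
    cleared : (X - p n) * (Z * D * pDen N) ≡ 1ℚ + ⟦ excess v₀ v₁ ⟧ (ℕ→ℚ t ∷ ℕ→ℚ u ∷ [])
    cleared = begin
      (X - p n) * (Z * D * pDen N)
        ≡⟨ solve 5 (λ x z d y e → (x :- y) :* (z :* d :* e) := (x :* z) :* d :* e :- (z :* d) :* (y :* e))
             refl X Z D (p n) (pDen N) ⟩
      (X * Z) * D * pDen N - (Z * D) * (p n * pDen N)
        ≡⟨ cong₂ (λ a b → a * D * pDen N - b) (⊘-cancelʳ P Z-pos) (cong₂ _*_ Z*D (p*pDen 2≤n)) ⟩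
      P * D * pDen N - (+ 12 / 1 * D + + 96 / 1) * (+ 2 / 1)
        ≡⟨ cong (λ a → a * pDen N - (+ 12 / 1 * D + + 96 / 1) * (+ 2 / 1)) (p*pDen 2≤c) ⟩
      pGap C N
        ≡⟨ cong₂ pGap (ℕ→ℚ-+ 96 t) (trans (ℕ→ℚ-+ (3 ℕ.* c) u) (cong (_+ ℕ→ℚ u) ℕ→ℚ-3c)) ⟩
      _ ≡⟨ solve 2 (λ t u → :pGap (con (+ 96 / 1) :+ t) (con (+ 3 / 1) :* (con (+ 96 / 1) :+ t) :+ u) := con 1ℚ :+ excess t u)
             refl (ℕ→ℚ t) (ℕ→ℚ u) ⟩
      1ℚ + ⟦ excess v₀ v₁ ⟧ (ℕ→ℚ t ∷ ℕ→ℚ u ∷ []) ∎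
      where open ≡-Reasoning

  -- (Y₀ + 11/12 - q b) * Z * D * E * qDen B after substituting Y₀ * Z = q c and the relations for p c, q c, q b
  qGap : ℚ → ℚ → ℚ
  qGap C B = pDen C * qDen B * (qDen C - (+ 3 / 1 * C - + 2 / 1))
           + (+ 12 / 1 * pDen C + + 96 / 1) * qDen C * ((+ 3 / 1 * B - + 2 / 1) - qDen B * (+ 1 / 12))

  :qGap : ∀ {n} → Polynomial n → Polynomial n → Polynomial n
  :qGap C B = :pDen C :* :qDen B :* (:qDen C :- (con (+ 3 / 1) :* C :- con (+ 2 / 1)))
            :+ (con (+ 12 / 1) :* :pDen C :+ con (+ 96 / 1)) :* :qDen C
               :* ((con (+ 3 / 1) :* B :- con (+ 2 / 1)) :- :qDen B :* con (+ 1 / 12))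

  q≤Y : ∀ s → 6 ℕ.+ s ℕ.≤ 3 ℕ.* c → q (6 ℕ.+ s) ≤ Y₀ + + 11 / 12
  q≤Y s b≤3c = 0≤q-p⇒p≤q (0≤-cancelʳ W-pos (subst (0ℚ ≤_) (sym cleared) (0≤⟦⟧ (excess v₀ v₁ v₂) (s ∷ t ∷ v ∷ []) tt)))
    where
    b = 6 ℕ.+ s
    B = ℕ→ℚ b
    v = proj₁ (ℕₚ.m≤n⇒∃[o]m+o≡n b≤3c)
    b+v≡3c = proj₂ (ℕₚ.m≤n⇒∃[o]m+o≡n b≤3c)
    2≤b = ℕₚ.m≤m+n 2 (4 ℕ.+ s)
    W-pos : 0ℚ < Z * D * E * qDen B
    W-pos = 0<p*q (0<p*q (0<p*q Z-pos (pDen-pos 2≤c)) (qDen-pos 2≤c)) (qDen-pos 2≤b)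
    G K : ∀ {n} → Polynomial n → Polynomial n
    G t = con (+ 2244656789760 / 1) :+ con (+ 141429569048 / 1) :* t :+ con (+ 3712104212 / 1) :* t :* t
      :+ con (+ 51951842 / 1) :* t :* t :* t :+ con (+ 408891 / 1) :* t :* t :* t :* t
      :+ con (+ 1716 / 1) :* t :* t :* t :* t :* t :+ con (+ 3 / 1) :* t :* t :* t :* t :* t :* t
    K t = con (+ 8 / 1) :* ((con (+ 96 / 1) :+ t) :* (con (+ 95 / 1) :+ t) :* (con (+ 98 / 1) :+ t))
      :+ (con (+ 286 / 1) :+ con (+ 3 / 1) :* t) :* (con (+ 95 / 1) :+ t) :* (con (+ 95 / 1) :+ t) :* (con (+ 98 / 1) :+ t)
    excess : ∀ {n} → Polynomial n → Polynomial n → Polynomial n → Polynomial n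
    excess s t v = (con (+ 16 / 1) :+ con (+ 3 / 1) :* s)
        :* (G t :+ K t :* v :* (con (+ 3 / 1) :* (con (+ 96 / 1) :+ t) :+ (con (+ 6 / 1) :+ s) :+ con (+ 2 / 1)) :* con (+ 1 / 3))
      :+ K t :* (con (+ 6 / 1) :+ s) :* (con (+ 8 / 1) :+ s) :* con (+ 1 / 3)
    S T V : ℚ
    S = ℕ→ℚ s
    T = ℕ→ℚ t
    V = ℕ→ℚ v
    3C-B≡V : + 3 / 1 * (+ 96 / 1 + T) - (+ 6 / 1 + S) ≡ V
    3C-B≡V = begin
      + 3 / 1 * (+ 96 / 1 + T) - (+ 6 / 1 + S)  ≡⟨ cong (λ a → a - (+ 6 / 1 + S)) (sym ℕ→ℚ-3c) ⟩
      ℕ→ℚ (3 ℕ.* c) - (+ 6 / 1 + S)            ≡⟨ cong₂ (λ a b → a - b) (cong ℕ→ℚ (sym b+v≡3c)) (sym (ℕ→ℚ-+ 6 s)) ⟩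
      ℕ→ℚ (b ℕ.+ v) - B                        ≡⟨ cong (_- B) (ℕ→ℚ-+ b v) ⟩
      (B + V) - B                              ≡⟨ solve 2 (λ x y → (x :+ y) :- x := y) refl B V ⟩
      V                                        ∎
      where open ≡-Reasoning
    cleared : (Y₀ + + 11 / 12 - q b) * (Z * D * E * qDen B) ≡ ⟦ excess v₀ v₁ v₂ ⟧ (S ∷ T ∷ V ∷ [])
    cleared = begin
      (Y₀ + + 11 / 12 - q b) * (Z * D * E * qDen B)
        ≡⟨ solve 6 (λ y z d e f x → ((y :+ con (+ 11 / 12)) :- x) :* (z :* d :* e :* f)
                      := d :* f :* (e :- (con 1ℚ :- y :* z) :* e) :+ (z :* d) :* e :* ((con 1ℚ :- x) :* f :- f :* con (+ 1 / 12)))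
             refl Y₀ Z D E (qDen B) (q b) ⟩
      D * qDen B * (E - (1ℚ - Y₀ * Z) * E) + (Z * D) * E * ((1ℚ - q b) * qDen B - qDen B * (+ 1 / 12))
        ≡⟨ cong (λ a → D * qDen B * (E - (1ℚ - a) * E) + (Z * D) * E * ((1ℚ - q b) * qDen B - qDen B * (+ 1 / 12)))
             (⊘-cancelʳ Q Z-pos) ⟩
      D * qDen B * (E - (1ℚ - Q) * E) + (Z * D) * E * ((1ℚ - q b) * qDen B - qDen B * (+ 1 / 12))
        ≡⟨ cong₂ (λ a w → D * qDen B * (E - a) + w * E * ((1ℚ - q b) * qDen B - qDen B * (+ 1 / 12)))
             ([1-q]*qDen 2≤c) Z*D ⟩
      D * qDen B * (E - (+ 3 / 1 * C - + 2 / 1)) + (+ 12 / 1 * D + + 96 / 1) * E * ((1ℚ - q b) * qDen B - qDen B * (+ 1 / 12))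
        ≡⟨ cong (λ a → D * qDen B * (E - (+ 3 / 1 * C - + 2 / 1)) + (+ 12 / 1 * D + + 96 / 1) * E * (a - qDen B * (+ 1 / 12)))
             ([1-q]*qDen 2≤b) ⟩
      qGap C B
        ≡⟨ cong₂ qGap (ℕ→ℚ-+ 96 t) (ℕ→ℚ-+ 6 s) ⟩
      _ ≡⟨ solve 2 (λ s t → :qGap (con (+ 96 / 1) :+ t) (con (+ 6 / 1) :+ s)
                            := excess s t (con (+ 3 / 1) :* (con (+ 96 / 1) :+ t) :- (con (+ 6 / 1) :+ s)))
             refl S T ⟩
      ⟦ excess v₀ v₁ v₂ ⟧ (S ∷ T ∷ (+ 3 / 1 * (+ 96 / 1 + T) - (+ 6 / 1 + S)) ∷ [])
        ≡⟨ cong (λ a → ⟦ excess v₀ v₁ v₂ ⟧ (S ∷ T ∷ a ∷ [])) 3C-B≡V ⟩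
      ⟦ excess v₀ v₁ v₂ ⟧ (S ∷ T ∷ V ∷ []) ∎
      where open ≡-Reasoning

  claim-at-9+ : ∀ s → Claim (+ (100 ℕ.+ t)) (+ (9 ℕ.+ s)) (+ (9 ℕ.+ s) +ℤ 1ℤ)
  claim-at-9+ s k[N+1]<X X≤kN = subst (Clockwise (X , Y₀ + + 11 / 12) (kℓ (+ (9 ℕ.+ s)))) (sym (kℓ-+1 (9 ℕ.+ s)))
    (clockwise-between (ℚₚ.<⇒≤ p[6+s]<X) X≤kN (q-mono (3 ℕ.+ s)) (q≤Y s 6+s≤3c))
    where
    p[6+s]<X : p (6 ℕ.+ s) < X
    p[6+s]<X = subst (λ a → proj₁ a < X) (kℓ-+1 (9 ℕ.+ s)) k[N+1]<X
    3c≰5+s : ¬ (3 ℕ.* c ℕ.≤ 5 ℕ.+ s)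
    3c≰5+s 3c≤5+s = let (u , 3c+u≡5+s) = ℕₚ.m≤n⇒∃[o]m+o≡n 3c≤5+s
                    in ≤⇒≯ X≤kN (subst (λ n → p n < X) 3c+u≡5+s (p<X u))
    6+s≤3c : 6 ℕ.+ s ℕ.≤ 3 ℕ.* c
    6+s≤3c = ℕₚ.≰⇒> 3c≰5+s

  claim : ∀ N → Claim (+ (100 ℕ.+ t)) N (N +ℤ 1ℤ)
  claim = claim-from-9≤N (+ (100 ℕ.+ t)) (ℚₚ.≤-<-trans X≤1/72 1/72<1/56) claim-at-9+

-- m = -(100 + t), where (k_m, ℓ_m) = (q c - 1/2, p c + 1/2)
module Negative (t : ℕ) where

  c : ℕ
  c = 96 ℕ.+ t

  κ μ : ℚ
  κ = q c - half
  μ = p c + half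

  3/8≤κ : + 3 / 8 ≤ κ
  3/8≤κ = ℚₚ.≤-trans (ℚₚ.≤ᵇ⇒≤ tt) (ℚₚ.+-monoˡ-≤ (- half) (7/8≤q (91 ℕ.+ t)))

  0≤κ : 0ℚ ≤ κ
  0≤κ = ℚₚ.≤-trans (ℚₚ.≤ᵇ⇒≤ tt) 3/8≤κ

  κ≤1/2 : κ ≤ half
  κ≤1/2 = ℚₚ.≤-trans (ℚₚ.+-monoˡ-≤ (- half) (q≤1 (94 ℕ.+ t))) (ℚₚ.≤ᵇ⇒≤ tt)

  1/2≤μ : half ≤ μ
  1/2≤μ = ℚₚ.+-monoˡ-≤ half (p-nonNeg (ℕₚ.m≤m+n 2 (94 ℕ.+ t)))

  claim-at-9+ : ∀ s → Claim -[1+ 99 ℕ.+ t ] (+ (9 ℕ.+ s)) (+ (9 ℕ.+ s) +ℤ 1ℤ)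
  claim-at-9+ 0 _ _ = clockwise-mono {a = kℓ (+ 9)} {b = kℓ (+ 10)} (1/80≤⊘scale 3/8≤κ)
    (ℚₚ.+-monoˡ-≤ (+ 11 / 12) (1/72≤⊘scale 0≤κ κ≤1/2 1/2≤μ))
    (ℚₚ.≤ᵇ⇒≤ tt) (ℚₚ.≤ᵇ⇒≤ tt) (ℚₚ.≤ᵇ⇒≤ tt)
  claim-at-9+ (suc s) _ X≤kN = ⊥-elim (ℚₚ.≤⇒≤ᵇ {+ 1 / 80} {+ 1 / 100}
    (ℚₚ.≤-trans (1/80≤⊘scale 3/8≤κ) (ℚₚ.≤-trans X≤kN (p≤1/100 s))))

  claim : ∀ N → Claim -[1+ 99 ℕ.+ t ] N (N +ℤ 1ℤ)
  claim = claim-from-9≤N -[1+ 99 ℕ.+ t ] (ℚₚ.≤-<-trans (⊘scale≤1/72 0≤κ κ≤1/2) 1/72<1/56) claim-at-9+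

lemma4p5 : (m N : ℤ) → ∣ m ∣ ≥ 100 →
    k (N +ℤ 1ℤ) < k m ⊘ ((Data.Integer.+ 12 / 1) * (1ℚ + (Data.Integer.+ 4 / 1) * k m)) →
    k m ⊘ ((Data.Integer.+ 12 / 1) * (1ℚ + (Data.Integer.+ 4 / 1) * k m)) ≤ k N →
    k N * ℓ (N +ℤ 1ℤ) - ℓ N * k (N +ℤ 1ℤ)
      ≤ (k m ⊘ ((Data.Integer.+ 12 / 1) * (1ℚ + (Data.Integer.+ 4 / 1) * k m))) * (ℓ (N +ℤ 1ℤ) - ℓ N)
        + (ℓ m ⊘ ((Data.Integer.+ 12 / 1) * (1ℚ + (Data.Integer.+ 4 / 1) * k m)) + Data.Integer.+ 11 / 12) * (k N - k (N +ℤ 1ℤ))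
lemma4p5 (+ n) N 100≤n =
  let (t , 100+t≡n) = ℕₚ.m≤n⇒∃[o]m+o≡n 100≤n
  in subst (λ n → Claim (+ n) N (N +ℤ 1ℤ)) 100+t≡n (Positive.claim t N)
lemma4p5 -[1+ n ] N 100≤1+n =
  let (t , 99+t≡n) = ℕₚ.m≤n⇒∃[o]m+o≡n (ℕ.s≤s⁻¹ 100≤1+n)
  in subst (λ n → Claim -[1+ n ] N (N +ℤ 1ℤ)) 99+t≡n (Negative.claim t N)
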